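{- For cycle graphs, $\mathrm{nim}(\mathrm{GEN}(C_{n}))=\mathrm{pty}(n)$.
   Context: $C_n$ with $n\ge 3$ is the cycle graph on $n$ vertices. For a graph $G=(V,E)$, a set of vertices is geodetically convex if it contains every vertex on every shortest path between two of its vertices; the convex hull $[P]$ is the smallest convex set containing $P$, and $P$ is generating if $[P]=V$. In the achievement game $\mathrm{GEN}(G)$, two players alternately select previously-unselected vertices; the game ends as soon as the selected set generates, and the last player to move wins. $\mathrm{nim}$ denotes the nim-number of an impartial game, and $\mathrm{pty}(n):=n\bmod 2$. -}

module Defs where

open import Data.Nat using (ℕ; zero; suc; _+_; _≡ᵇ_; _%_)
open import Data.Bool using (Bool; true; false; _∧_; _∨_; not; if_then_else_)
open import Data.Fin using (Fin; toℕ; _≟_)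
import Data.Fin as Fin
open import Data.List using (List; []; _∷_; map; concatMap; upTo; allFin; length; [_])
open import Data.Bool.ListAction using (any; all)
open import Relation.Nullary.Decidable using (⌊_⌋)

Graph : ℕ → Set
Graph n = Fin n → Fin n → Bool

VSet : ℕ → Set
VSet n = Fin n → Bool

eqV : ∀ {n} → Fin n → Fin n → Bool
eqV i j = ⌊ i ≟ j ⌋

-- The cycle graph C_n on vertices 0,…,n-1: i ~ j iff j = i+1 (mod n)
-- or i = j+1 (mod n).  (For n ≥ 3 this is exactly C_n.)
cycleGraph : (n : ℕ) → Graph n
cycleGraph n i j =
  (b ≡ᵇ suc a) ∨ (a ≡ᵇ suc b) ∨ ((a ≡ᵇ 0) ∧ (suc b ≡ᵇ n)) ∨ ((b ≡ᵇ 0) ∧ (suc a ≡ᵇ n))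
  where
  a = toℕ i
  b = toℕ j

walk : ∀ {n} → Graph n → ℕ → Fin n → Fin n → Bool
walk {n} G zero    u v = eqV u v
walk {n} G (suc k) u v = any (λ w → G u w ∧ walk G k w v) (allFin n)

-- onShortestPath G u v w : w lies on some shortest u–v path, i.e. there is a
-- walk from u through w to v (of lengths a and b) whose total length a + b is
-- minimal among all u–v walks (a shortest walk is a path).  Shortest paths in
-- a graph on n vertices have length < n, so a, b ≤ n suffices.
onShortestPath : ∀ {n} → Graph n → Fin n → Fin n → Fin n → Bool
onShortestPath {n} G u v w =
  any (λ a → any (λ b →
        walk G a u w ∧ walk G b w v
        ∧ not (any (λ c → walk G c u v) (upTo (a + b))))
      (upTo (suc n))) (upTo (suc n))

convex : ∀ {n} → Graph n → VSet n → Bool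
convex {n} G S =
  all (λ u → all (λ v → all (λ w →
    not (S u ∧ S v ∧ onShortestPath G u v w) ∨ S w)
    (allFin n)) (allFin n)) (allFin n)

_⊆ᵇ_ : ∀ {n} → VSet n → VSet n → Bool
_⊆ᵇ_ {n} P S = all (λ v → not (P v) ∨ S v) (allFin n)

isFull : ∀ {n} → VSet n → Bool
isFull {n} S = all S (allFin n)

consV : ∀ {n} → Bool → VSet n → VSet (suc n)
consV b S Fin.zero    = b
consV b S (Fin.suc i) = S i

allSubsets : (n : ℕ) → List (VSet n)
allSubsets zero    = [ (λ ()) ]
allSubsets (suc n) =
  concatMap (λ S → consV true S ∷ consV false S ∷ [])
            (allSubsets n)

-- P is generating: its convex hull [P] (the smallest convex set containing P,
-- i.e. the intersection of all convex supersets of P) is all of V;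
-- equivalently every convex set containing P is V.
generating : ∀ {n} → Graph n → VSet n → Bool
generating {n} G P =
  all (λ S → not (convex G S ∧ (P ⊆ᵇ S)) ∨ isFull S) (allSubsets n)

elemℕ : ℕ → List ℕ → Bool
elemℕ k xs = any (λ x → k ≡ᵇ x) xs

mexFrom : ℕ → ℕ → List ℕ → ℕ
mexFrom zero    k xs = k
mexFrom (suc f) k xs = if elemℕ k xs then mexFrom f (suc k) xs else k

mex : List ℕ → ℕ
mex xs = mexFrom (suc (length xs)) 0 xs

insertV : ∀ {n} → VSet n → Fin n → VSet n
insertV P v w = eqV w v ∨ P w

-- Nim-number of the position of GEN(G) in which the set P is selected.  The fuel argument is the
-- number of further moves allowed; n moves always suffice (V generates).
nimFrom : ∀ {n} → Graph n → ℕ → VSet n → ℕ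
nimFrom {n} G zero    P = 0
nimFrom {n} G (suc f) P =
  if generating G P then 0
  else mex (concatMap (λ v → if P v then [] else [ nimFrom G f (insertV P v) ])
                      (allFin n))

nimGEN : ∀ {n} → Graph n → ℕ
nimGEN {n} G = nimFrom G n (λ _ → false)

pty : ℕ → ℕ
pty n = n % 2

{-# OPTIONS --safe #-}
-- A walk of length c from x to y forces toℕ x − toℕ y to lie within c of a multiple of n.
-- Hence d ≤ n/2 consecutive steps along the cycle form a shortest path, and an arc of
-- m + 1 consecutive vertices with 2m < n is convex; ∅ and singletons are convex in any graph.
-- For n = 2m two antipodal vertices generate, so the second player answers every first
-- move with its antipode and the start has value 0.  For n = 2m + 1 every pair lies in a
-- convex arc of m + 1 vertices and does not generate, but it is completed to a generating
-- triple by the vertex m steps beyond one of its points; so every pair position has a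
-- winning move, every singleton has value 0, and the start has value mex {0} = 1.
module Submission where

open import Defs
open import Data.Nat using (ℕ; zero; suc; _+_; _*_; _∸_; _≤_; _<_; z≤n; s≤s; z<s; _≡ᵇ_; _≤ᵇ_; NonZero; ≢-nonZero; _>_; >-nonZero; >-nonZero⁻¹; _%_; _/_)
open import Data.Nat.Properties
open import Data.Nat.DivMod
open import Algebra.Properties.CommutativeSemigroup +-commutativeSemigroup using (x∙yz≈y∙xz; xy∙z≈xz∙y; interchange)
open import Data.Integer using (ℤ; +_; -_; ∣_∣; 0ℤ; 1ℤ; -1ℤ) renaming (_+_ to _+ℤ_; _-_ to _-ℤ_; _*_ to _*ℤ_)
import Data.Integer.Properties as ℤ
open import Data.Integer.Tactic.RingSolver using (solve-∀)
open import Data.Bool using (Bool; true; false; T; not; _∧_; _∨_; if_then_else_)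
open import Data.Bool.Properties using (T-∧)
open import Data.Bool.ListAction using (any; all)
open import Data.Fin using (Fin; toℕ; fromℕ<)
import Data.Fin as Fin
open import Data.Fin.Properties using (toℕ-injective; toℕ<n; toℕ-fromℕ<)
open import Data.List using (List; []; _∷_; [_]; concatMap; allFin; upTo; length)
open import Data.List.Relation.Unary.Any using (here; there)
import Data.List.Relation.Unary.Any as Any
open import Data.List.Relation.Unary.Any.Properties using (any⁺; any⁻)
open import Data.List.Relation.Unary.All using (lookup; tabulate)
open import Data.List.Relation.Unary.All.Properties using (all⁺; all⁻)
open import Data.List.Membership.Propositional using (_∈_; _∉_; find; lose)
open import Data.List.Membership.Propositional.Properties using (∈-allFin; ∈-upTo⁺; ∈-upTo⁻; ∈-concatMap⁺; ∈-concatMap⁻)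
open import Data.Product using (∃-syntax; _×_; _,_; proj₁; proj₂)
open import Data.Sum using (_⊎_; inj₁; inj₂)
open import Data.Empty using (⊥; ⊥-elim)
open import Data.Unit using (tt)
open import Function.Base using (_∘_)
open import Function.Bundles using (Equivalence)
open import Relation.Nullary using (¬_; yes; no; contradiction)
open import Relation.Nullary.Decidable using (fromWitness; toWitness)
open import Relation.Binary.PropositionalEquality using (_≡_; _≢_; _≗_; refl; sym; trans; cong; cong₂; subst; subst₂; module ≡-Reasoning)

T-∧⁺ : ∀ {a b} → T a → T b → T (a ∧ b)
T-∧⁺ ta tb = Equivalence.from T-∧ (ta , tb)

T-∧⁻ : ∀ {a b} → T (a ∧ b) → T a × T b
T-∧⁻ = Equivalence.to T-∧

T-∨ˡ : ∀ {a b} → T a → T (a ∨ b)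
T-∨ˡ {true} _ = tt

T-∨ʳ : ∀ {a b} → T b → T (a ∨ b)
T-∨ʳ {true}  _  = tt
T-∨ʳ {false} tb = tb

T-∨⁻ : ∀ a {b} → T (a ∨ b) → T a ⊎ T b
T-∨⁻ true  _  = inj₁ tt
T-∨⁻ false tb = inj₂ tb

T-not⁺ : ∀ {a} → ¬ T a → T (not a)
T-not⁺ {false} _  = tt
T-not⁺ {true}  ¬a = ¬a tt

T-not⁻ : ∀ {a} → T (not a) → ¬ T a
T-not⁻ {false} _ ()

T-⇒⁺ : ∀ {a b} → (T a → T b) → T (not a ∨ b)
T-⇒⁺ {false} _ = tt
T-⇒⁺ {true}  f = f tt

T-⇒⁻ : ∀ {a b} → T (not a ∨ b) → T a → T b
T-⇒⁻ {true} tb _ = tb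

module _ {A : Set} (p : A → Bool) where

  any-intro : ∀ {x xs} → x ∈ xs → T (p x) → T (any p xs)
  any-intro x∈xs px = any⁺ p (lose x∈xs px)

  any-elim : ∀ xs → T (any p xs) → ∃[ x ] x ∈ xs × T (p x)
  any-elim xs h = find (any⁻ p xs h)

  all-intro : ∀ xs → (∀ {x} → x ∈ xs → T (p x)) → T (all p xs)
  all-intro xs h = all⁻ p (tabulate h)

  all-elim : ∀ {x xs} → T (all p xs) → x ∈ xs → T (p x)
  all-elim {xs = xs} h = lookup (all⁺ p xs h)

all-allFin-intro : ∀ {n} (p : Fin n → Bool) → (∀ x → T (p x)) → T (all p (allFin n))
all-allFin-intro {n} p h = all-intro p (allFin n) (λ {x} _ → h x)

all-allFin-elim : ∀ {n} (p : Fin n → Bool) → T (all p (allFin n)) → ∀ x → T (p x)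
all-allFin-elim p h x = all-elim p h (∈-allFin x)

_⊆_ : ∀ {n} → VSet n → VSet n → Set
P ⊆ S = ∀ x → T (P x) → T (S x)

⊆ᵇ⁺ : ∀ {n} {P S : VSet n} → P ⊆ S → T (P ⊆ᵇ S)
⊆ᵇ⁺ P⊆S = all-allFin-intro _ (λ x → T-⇒⁺ (P⊆S x))

⊆ᵇ⁻ : ∀ {n} {P S : VSet n} → T (P ⊆ᵇ S) → P ⊆ S
⊆ᵇ⁻ h x = T-⇒⁻ (all-allFin-elim _ h x)

∅ : ∀ {n} → VSet n
∅ _ = false

∈-insertV : ∀ {n} (P : VSet n) v → T (insertV P v v)
∈-insertV P v = T-∨ˡ {eqV v v} (fromWitness refl)

∈-insertV-old : ∀ {n} {P : VSet n} v y → T (P y) → T (insertV P v y)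
∈-insertV-old v y = T-∨ʳ {eqV y v}

∈-insertV⁻ : ∀ {n} {P : VSet n} {v y} → T (insertV P v y) → y ≡ v ⊎ T (P y)
∈-insertV⁻ {v = v} {y} h with T-∨⁻ (eqV y v) h
... | inj₁ y≡v = inj₁ (toWitness y≡v)
... | inj₂ py  = inj₂ py

∉-insertV : ∀ {n} {P : VSet n} {v y} → y ≢ v → ¬ T (P y) → ¬ T (insertV P v y)
∉-insertV {P = P} y≢v ¬py h with ∈-insertV⁻ {P = P} h
... | inj₁ y≡v = y≢v y≡v
... | inj₂ py  = ¬py py

pair : ∀ {n} → Fin n → Fin n → VSet n
pair v w = insertV (insertV ∅ v) w

∈-pairˡ : ∀ {n} (v w : Fin n) → T (pair v w v)
∈-pairˡ v w = ∈-insertV-old {P = insertV ∅ v} w v (∈-insertV ∅ v)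

∈-pairʳ : ∀ {n} (v w : Fin n) → T (pair v w w)
∈-pairʳ v w = ∈-insertV (insertV ∅ v) w

∈-pair⁻ : ∀ {n} {v w x : Fin n} → T (pair v w x) → x ≡ v ⊎ x ≡ w
∈-pair⁻ {v = v} {w} {x} h with ∈-insertV⁻ {P = insertV ∅ v} {w} {x} h
... | inj₁ x≡w  = inj₂ x≡w
... | inj₂ x∈⟨v⟩ with ∈-insertV⁻ {P = ∅} {v} {x} x∈⟨v⟩
...   | inj₁ x≡v = inj₁ x≡v

∉-pair : ∀ {n} {v w x : Fin n} → x ≢ v → x ≢ w → ¬ T (pair v w x)
∉-pair {v = v} x≢v x≢w = ∉-insertV {P = insertV ∅ v} x≢w (∉-insertV {P = ∅} x≢v λ ())

allSubsets-complete : ∀ n (S : VSet n) → ∃[ S′ ] S′ ∈ allSubsets n × S′ ≗ S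
allSubsets-complete zero    S = (λ ()) , here refl , λ ()
allSubsets-complete (suc n) S with allSubsets-complete n (λ i → S (Fin.suc i))
... | S′ , S′∈ , S′≗ = consV (S Fin.zero) S′ , ∈-concatMap⁺ _ (Any.map cons∈ S′∈) , cons≗
  where
  cons∈ : ∀ {R} → S′ ≡ R → consV (S Fin.zero) S′ ∈ consV true R ∷ consV false R ∷ []
  cons∈ refl with S Fin.zero
  ... | true  = here refl
  ... | false = there (here refl)
  cons≗ : consV (S Fin.zero) S′ ≗ S
  cons≗ Fin.zero    = refl
  cons≗ (Fin.suc i) = S′≗ i

elemℕ⁺ : ∀ {k xs} → k ∈ xs → T (elemℕ k xs)
elemℕ⁺ {k} k∈xs = any-intro (k ≡ᵇ_) k∈xs (≡⇒≡ᵇ k k refl)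

elemℕ⁻ : ∀ {k xs} → T (elemℕ k xs) → k ∈ xs
elemℕ⁻ {k} {xs} h with any-elim (k ≡ᵇ_) xs h
... | x , x∈xs , k≡ᵇx = subst (_∈ xs) (sym (≡ᵇ⇒≡ k x k≡ᵇx)) x∈xs

mexFrom-≥ : ∀ f k xs → k ≤ mexFrom f k xs
mexFrom-≥ zero    k xs = ≤-refl
mexFrom-≥ (suc f) k xs with elemℕ k xs
... | true  = ≤-trans (n≤1+n k) (mexFrom-≥ f (suc k) xs)
... | false = ≤-refl

mex≡0 : ∀ {xs} → 0 ∉ xs → mex xs ≡ 0
mex≡0 {xs} 0∉xs with elemℕ 0 xs in e
... | true  = contradiction (elemℕ⁻ (subst T (sym e) tt)) 0∉xs
... | false = refl

mex>0 : ∀ {xs} → 0 ∈ xs → mex xs > 0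
mex>0 {xs} 0∈xs with elemℕ 0 xs | elemℕ⁺ 0∈xs
... | true | _ = mexFrom-≥ (length xs) 1 xs

mex≡1 : ∀ {xs} → 0 ∈ xs → 1 ∉ xs → mex xs ≡ 1
mex≡1 {x ∷ xs} 0∈xs 1∉xs with elemℕ 0 (x ∷ xs) | elemℕ⁺ 0∈xs | elemℕ 1 (x ∷ xs) in e
... | true | _ | false = refl
... | true | _ | true  = contradiction (elemℕ⁻ (subst T (sym e) tt)) 1∉xs

module GEN {n : ℕ} (G : Graph n) where

  record OnShortestPath (u v w : Fin n) : Set where
    field
      before after : ℕ
      walk-before  : T (walk G before u w)
      walk-after   : T (walk G after w v)
      shortest     : ∀ c → c < before + after → ¬ T (walk G c u v)

  onShortestPath⁻ : ∀ {u v w} → T (onShortestPath G u v w) → OnShortestPath u v w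
  onShortestPath⁻ {u} {v} {w} h with any-elim _ (upTo (suc n)) h
  ... | a , _ , h′ with any-elim _ (upTo (suc n)) h′
  ... | b , _ , h″ with T-∧⁻ h″
  ... | wa , h‴ with T-∧⁻ {walk G b w v} h‴
  ... | wb , ¬short = record
    { before = a ; after = b ; walk-before = wa ; walk-after = wb
    ; shortest = λ c c< wc → T-not⁻ ¬short (any-intro _ (∈-upTo⁺ c<) wc)
    }

  onShortestPath⁺ : ∀ {u v w} (p : OnShortestPath u v w) → let open OnShortestPath p in
                    before ≤ n → after ≤ n → T (onShortestPath G u v w)
  onShortestPath⁺ p a≤n b≤n =
    any-intro _ (∈-upTo⁺ (s≤s a≤n)) (any-intro _ (∈-upTo⁺ (s≤s b≤n))
      (T-∧⁺ walk-before (T-∧⁺ walk-after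
        (T-not⁺ λ h → let c , c∈ , wc = any-elim _ _ h in shortest c (∈-upTo⁻ c∈) wc))))
    where open OnShortestPath p

  Convex : VSet n → Set
  Convex S = ∀ u v w → T (S u) → T (S v) → T (onShortestPath G u v w) → T (S w)

  convex⁺ : ∀ {S} → Convex S → T (convex G S)
  convex⁺ h = all-allFin-intro _ λ u → all-allFin-intro _ λ v → all-allFin-intro _ λ w →
    T-⇒⁺ λ suvw → let su , svw = T-∧⁻ suvw ; sv , uvw = T-∧⁻ svw in h u v w su sv uvw

  convex⁻ : ∀ {S} → T (convex G S) → Convex S
  convex⁻ h u v w su sv uvw =
    T-⇒⁻ (all-allFin-elim _ (all-allFin-elim _ (all-allFin-elim _ h u) v) w) (T-∧⁺ su (T-∧⁺ sv uvw))

  convex-resp-≗ : ∀ {S S′} → S ≗ S′ → Convex S → Convex S′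
  convex-resp-≗ S≗S′ h u v w su sv uvw =
    subst T (S≗S′ w) (h u v w (subst T (sym (S≗S′ u)) su) (subst T (sym (S≗S′ v)) sv) uvw)

  generating⁺ : ∀ {P} → (∀ S → Convex S → P ⊆ S → ∀ x → T (S x)) → T (generating G P)
  generating⁺ h = all-intro _ (allSubsets n) λ {S} _ →
    T-⇒⁺ λ c∧⊆ → let c , ⊆ = T-∧⁻ c∧⊆ in
      all-allFin-intro S (h S (convex⁻ c) (⊆ᵇ⁻ ⊆))

  generating⁻ : ∀ {P} → T (generating G P) → ∀ S → Convex S → P ⊆ S → ∀ x → T (S x)
  generating⁻ {P} h S conv P⊆S x with allSubsets-complete n S
  ... | S′ , S′∈ , S′≗S =
    subst T (S′≗S x) (all-allFin-elim S′ (T-⇒⁻ (all-elim _ h S′∈) (T-∧⁺ conv′ (⊆ᵇ⁺ P⊆S′))) x)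
    where
    conv′ : T (convex G S′)
    conv′ = convex⁺ (convex-resp-≗ (λ y → sym (S′≗S y)) conv)
    P⊆S′ : P ⊆ S′
    P⊆S′ y py = subst T (sym (S′≗S y)) (P⊆S y py)

  onShortestPath-self : ∀ {v w} → T (onShortestPath G v v w) → w ≡ v
  onShortestPath-self h with onShortestPath⁻ h
  ... | record { before = zero ; walk-before = v≡w } = sym (toWitness v≡w)
  ... | record { before = suc _ ; shortest = shortest } = contradiction (fromWitness refl) (shortest 0 (s≤s z≤n))

  ∅-convex : Convex ∅
  ∅-convex _ _ _ ()

  singleton-convex : ∀ v → Convex (insertV ∅ v)
  singleton-convex v u u′ w su su′ h with ∈-insertV⁻ {P = ∅} su | ∈-insertV⁻ {P = ∅} su′
  ... | inj₁ refl | inj₁ refl = subst (T ∘ insertV ∅ v) (sym (onShortestPath-self h)) (∈-insertV ∅ v)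

  nonGenerating : ∀ {P S y} → Convex S → P ⊆ S → ¬ T (S y) → ¬ T (generating G P)
  nonGenerating conv P⊆S ¬sy gen = ¬sy (generating⁻ gen _ conv P⊆S _)

  options : ℕ → VSet n → List ℕ
  options f P = concatMap (λ v → if P v then [] else [ nimFrom G f (insertV P v) ]) (allFin n)

  ∈-options⁺ : ∀ {f P v} → ¬ T (P v) → nimFrom G f (insertV P v) ∈ options f P
  ∈-options⁺ {f} {P} {v} ¬pv = ∈-concatMap⁺ _ (lose (∈-allFin v) option∈)
    where
    option∈ : nimFrom G f (insertV P v) ∈ (if P v then [] else [ nimFrom G f (insertV P v) ])
    option∈ with P v
    ... | true  = contradiction tt ¬pv
    ... | false = here refl

  ∈-options⁻ : ∀ {f P y} → y ∈ options f P → ∃[ v ] ¬ T (P v) × y ≡ nimFrom G f (insertV P v)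
  ∈-options⁻ {f} {P} {y} y∈ with find (∈-concatMap⁻ _ {xs = allFin n} y∈)
  ... | v , _ , y∈option with P v in pv
  ... | false with y∈option
  ...   | here y≡ = v , subst T pv , y≡

  nimFrom-generating : ∀ {f P} → T (generating G P) → nimFrom G f P ≡ 0
  nimFrom-generating {zero}      _   = refl
  nimFrom-generating {suc f} {P} gen with generating G P
  ... | true = refl

  nimFrom-suc : ∀ {f P} → ¬ T (generating G P) → nimFrom G (suc f) P ≡ mex (options f P)
  nimFrom-suc {f} {P} ¬gen with generating G P
  ... | true  = contradiction tt ¬gen
  ... | false = refl

  nimFrom≡0 : ∀ {f P} → ¬ T (generating G P) →
              (∀ v → ¬ T (P v) → nimFrom G f (insertV P v) ≢ 0) → nimFrom G (suc f) P ≡ 0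
  nimFrom≡0 {f} {P} ¬gen options≢0 = trans (nimFrom-suc {f} ¬gen) (mex≡0 λ 0∈ →
    let v , ¬pv , 0≡ = ∈-options⁻ {f} {P} 0∈ in options≢0 v ¬pv (sym 0≡))

  nimFrom≢0 : ∀ {f P v} → ¬ T (generating G P) → ¬ T (P v) →
              T (generating G (insertV P v)) → nimFrom G (suc f) P ≢ 0
  nimFrom≢0 {f} {P} ¬gen ¬pv gen = subst (_≢ 0) (sym (nimFrom-suc {f} ¬gen))
    (m<n⇒n≢0 (mex>0 (subst (_∈ options f P) (nimFrom-generating {f} gen) (∈-options⁺ {f} ¬pv))))

  nimFrom≡1 : ∀ {f P v} → ¬ T (generating G P) → ¬ T (P v) →
              (∀ w → ¬ T (P w) → nimFrom G f (insertV P w) ≡ 0) → nimFrom G (suc f) P ≡ 1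
  nimFrom≡1 {f} {P} ¬gen ¬pv options≡0 = trans (nimFrom-suc {f} ¬gen)
    (mex≡1 (subst (_∈ options f P) (options≡0 _ ¬pv) (∈-options⁺ {f} ¬pv))
           (λ 1∈ → let w , ¬pw , 1≡ = ∈-options⁻ {f} {P} 1∈ in contradiction (trans 1≡ (options≡0 w ¬pw)) λ ()))

diff-negate : ∀ x y t N → - (x -ℤ y +ℤ t *ℤ N) ≡ y -ℤ x +ℤ - t *ℤ N
diff-negate = solve-∀

diff-add : ∀ x y z t u N → (x -ℤ y +ℤ t *ℤ N) +ℤ (y -ℤ z +ℤ u *ℤ N) ≡ x -ℤ z +ℤ (t +ℤ u) *ℤ N
diff-add = solve-∀

diff-translate : ∀ s x y k → x -ℤ y +ℤ k ≡ (s +ℤ x) -ℤ (s +ℤ y) +ℤ k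
diff-translate = solve-∀

diff-shift : ∀ x y q r t N → (x +ℤ q *ℤ N) -ℤ (y +ℤ r *ℤ N) +ℤ (t -ℤ q +ℤ r) *ℤ N ≡ x -ℤ y +ℤ t *ℤ N
diff-shift = solve-∀

diff-0N : ∀ x y N → x -ℤ y +ℤ 0ℤ *ℤ N ≡ x -ℤ y
diff-0N = solve-∀

diff-self : ∀ x N → x -ℤ x +ℤ 0ℤ *ℤ N ≡ 0ℤ
diff-self = solve-∀

diff-succ : ∀ x N → x -ℤ (1ℤ +ℤ x) +ℤ 0ℤ *ℤ N ≡ -1ℤ
diff-succ = solve-∀

diff-wrap : ∀ x → x -ℤ 0ℤ +ℤ -1ℤ *ℤ (1ℤ +ℤ x) ≡ -1ℤ
diff-wrap = solve-∀

add-sub-cancel : ∀ z w → (z +ℤ w) -ℤ z ≡ w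
add-sub-cancel = solve-∀

module _ {n m : ℕ} (m+m<n : m + m < n) where

  wrap-once-impossible : ∀ {i j k a b} → n + i ≤ a + k → k ≤ b + j → a + b + (i + j) ≤ m + m → ⊥
  wrap-once-impossible {i} {j} {k} {a} {b} n+i≤a+k k≤b+j a+b+[i+j]≤m+m = <⇒≱ m+m<n (begin
    n                  ≤⟨ m≤m+n n i ⟩
    n + i              ≤⟨ +-cancelʳ-≤ k (n + i) (a + b + j) (begin
      n + i + k          ≤⟨ +-mono-≤ n+i≤a+k k≤b+j ⟩
      (a + k) + (b + j)  ≡⟨ interchange a k b j ⟩
      (a + b) + (k + j)  ≡⟨ cong (λ z → a + b + z) (+-comm k j) ⟩
      (a + b) + (j + k)  ≡⟨ +-assoc (a + b) j k ⟨
      a + b + j + k      ∎) ⟩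
    a + b + j          ≤⟨ +-monoʳ-≤ (a + b) (m≤n+m j i) ⟩
    a + b + (i + j)    ≤⟨ a+b+[i+j]≤m+m ⟩
    m + m              ∎)
    where open ≤-Reasoning

  outside-arc-unreachable : ∀ {i j k a b} → m < k → k < n → a + b + (i + j) ≤ m + m → a + b ≤ i + j →
                            k ≤ a + i ⊎ n + i ≤ a + k → k ≤ b + j ⊎ n + j ≤ b + k → ⊥
  outside-arc-unreachable {i} {j} {k} {a} {b} m<k _ a+b+[i+j]≤m+m _ (inj₁ k≤a+i) (inj₁ k≤b+j) =
    <⇒≱ (+-mono-< m<k m<k) (begin
      k + k              ≤⟨ +-mono-≤ k≤a+i k≤b+j ⟩
      (a + i) + (b + j)  ≡⟨ interchange a i b j ⟩
      (a + b) + (i + j)  ≤⟨ a+b+[i+j]≤m+m ⟩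
      m + m              ∎)
    where open ≤-Reasoning
  outside-arc-unreachable _ _ a+b+[i+j]≤m+m _ (inj₂ n+i≤a+k) (inj₁ k≤b+j) =
    wrap-once-impossible n+i≤a+k k≤b+j a+b+[i+j]≤m+m
  outside-arc-unreachable {i} {j} {k} {a} {b} _ _ a+b+[i+j]≤m+m _ (inj₁ k≤a+i) (inj₂ n+j≤b+k) =
    wrap-once-impossible n+j≤b+k k≤a+i (subst (_≤ m + m) (cong₂ _+_ (+-comm a b) (+-comm i j)) a+b+[i+j]≤m+m)
  outside-arc-unreachable {i} {j} {k} {a} {b} _ k<n _ a+b≤i+j (inj₂ n+i≤a+k) (inj₂ n+j≤b+k) =
    <⇒≱ (+-mono-< k<n k<n) (+-cancelʳ-≤ (i + j) (n + n) (k + k) (begin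
      (n + n) + (i + j)  ≡⟨ interchange n i n j ⟨
      (n + i) + (n + j)  ≤⟨ +-mono-≤ n+i≤a+k n+j≤b+k ⟩
      (a + k) + (b + k)  ≡⟨ interchange a k b k ⟩
      (a + b) + (k + k)  ≤⟨ +-monoˡ-≤ (k + k) a+b≤i+j ⟩
      (i + j) + (k + k)  ≡⟨ +-comm (i + j) (k + k) ⟩
      (k + k) + (i + j)  ∎))
    where open ≤-Reasoning

distance-bounds : ∀ {i j m} → i ≤ j → j ≤ m → (j ∸ i) + (i + j) ≤ m + m × j ∸ i ≤ i + j
distance-bounds {i} {j} i≤j j≤m =
  ≤-trans (≤-reflexive (trans (sym (+-assoc (j ∸ i) i j)) (cong (_+ j) (m∸n+n≡m i≤j)))) (+-mono-≤ j≤m j≤m) ,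
  ≤-trans (m∸n≤m j i) (m≤n+m j i)

∣i-k∣≡k∸i : ∀ {i k} → i ≤ k → ∣ + i -ℤ + k ∣ ≡ k ∸ i
∣i-k∣≡k∸i {i} {k} i≤k = trans (cong ∣_∣ (ℤ.m-n≡m⊖n i k)) (ℤ.∣⊖∣-≤ i≤k)

module Cycle (n : ℕ) {{_ : NonZero n}} where

  0<n : 0 < n
  0<n = >-nonZero⁻¹ n

  C : Graph n
  C = cycleGraph n

  open GEN C

  infixl 6 _⊕_

  _⊕_ : Fin n → ℕ → Fin n
  s ⊕ d = fromℕ< (m%n<n (toℕ s + d) n)

  offset : Fin n → Fin n → ℕ
  offset s y = (toℕ y + (n ∸ toℕ s)) % n

  toℕ-⊕ : ∀ s d → toℕ (s ⊕ d) ≡ (toℕ s + d) % n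
  toℕ-⊕ s d = toℕ-fromℕ< (m%n<n (toℕ s + d) n)

  %-absorbʳ : ∀ a b → (a + b % n) % n ≡ (a + b) % n
  %-absorbʳ a b = begin
    (a + b % n) % n          ≡⟨ %-distribˡ-+ a (b % n) n ⟩
    (a % n + b % n % n) % n  ≡⟨ cong (λ z → (a % n + z) % n) (m%n%n≡m%n b n) ⟩
    (a % n + b % n) % n      ≡⟨ %-distribˡ-+ a b n ⟨
    (a + b) % n              ∎
    where open ≡-Reasoning

  %-absorbˡ : ∀ a b → (a % n + b) % n ≡ (a + b) % n
  %-absorbˡ a b = begin
    (a % n + b) % n ≡⟨ cong (_% n) (+-comm (a % n) b) ⟩
    (b + a % n) % n ≡⟨ %-absorbʳ b a ⟩
    (b + a) % n     ≡⟨ cong (_% n) (+-comm b a) ⟩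
    (a + b) % n     ∎
    where open ≡-Reasoning

  ⊕-assoc : ∀ s a b → s ⊕ a ⊕ b ≡ s ⊕ (a + b)
  ⊕-assoc s a b = toℕ-injective (begin
    toℕ (s ⊕ a ⊕ b)           ≡⟨ toℕ-⊕ (s ⊕ a) b ⟩
    (toℕ (s ⊕ a) + b) % n     ≡⟨ cong (λ z → (z + b) % n) (toℕ-⊕ s a) ⟩
    ((toℕ s + a) % n + b) % n ≡⟨ %-absorbˡ (toℕ s + a) b ⟩
    (toℕ s + a + b) % n       ≡⟨ cong (_% n) (+-assoc (toℕ s) a b) ⟩
    (toℕ s + (a + b)) % n     ≡⟨ toℕ-⊕ s (a + b) ⟨
    toℕ (s ⊕ (a + b))         ∎)
    where open ≡-Reasoning

  ⊕-identityʳ : ∀ s → s ⊕ 0 ≡ s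
  ⊕-identityʳ s = toℕ-injective (begin
    toℕ (s ⊕ 0)       ≡⟨ toℕ-⊕ s 0 ⟩
    (toℕ s + 0) % n   ≡⟨ cong (_% n) (+-identityʳ (toℕ s)) ⟩
    toℕ s % n         ≡⟨ m<n⇒m%n≡m (toℕ<n s) ⟩
    toℕ s             ∎)
    where open ≡-Reasoning

  ⊕-n : ∀ s → s ⊕ n ≡ s
  ⊕-n s = toℕ-injective (begin
    toℕ (s ⊕ n)       ≡⟨ toℕ-⊕ s n ⟩
    (toℕ s + n) % n   ≡⟨ [m+n]%n≡m%n (toℕ s) n ⟩
    toℕ s % n         ≡⟨ m<n⇒m%n≡m (toℕ<n s) ⟩
    toℕ s             ∎)
    where open ≡-Reasoning

  offset<n : ∀ s y → offset s y < n
  offset<n s y = m%n<n _ n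

  ⊕-offset : ∀ s y → s ⊕ offset s y ≡ y
  ⊕-offset s y = toℕ-injective (begin
    toℕ (s ⊕ offset s y)                      ≡⟨ toℕ-⊕ s (offset s y) ⟩
    (toℕ s + (toℕ y + (n ∸ toℕ s)) % n) % n   ≡⟨ %-absorbʳ (toℕ s) _ ⟩
    (toℕ s + (toℕ y + (n ∸ toℕ s))) % n       ≡⟨ cong (_% n) (rearrange (toℕ s) (toℕ y) (<⇒≤ (toℕ<n s))) ⟩
    (toℕ y + n) % n                           ≡⟨ [m+n]%n≡m%n (toℕ y) n ⟩
    toℕ y % n                                 ≡⟨ m<n⇒m%n≡m (toℕ<n y) ⟩
    toℕ y                                     ∎)
    where
    open ≡-Reasoning
    rearrange : ∀ a b → a ≤ n → a + (b + (n ∸ a)) ≡ b + n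
    rearrange a b a≤n = begin
      a + (b + (n ∸ a)) ≡⟨ x∙yz≈y∙xz a b (n ∸ a) ⟩
      b + (a + (n ∸ a)) ≡⟨ cong (λ z → b + z) (m+[n∸m]≡n a≤n) ⟩
      b + n             ∎

  offset-⊕ : ∀ s d → d < n → offset s (s ⊕ d) ≡ d
  offset-⊕ s d d<n = begin
    (toℕ (s ⊕ d) + (n ∸ toℕ s)) % n       ≡⟨ cong (λ z → (z + (n ∸ toℕ s)) % n) (toℕ-⊕ s d) ⟩
    ((toℕ s + d) % n + (n ∸ toℕ s)) % n   ≡⟨ %-absorbˡ (toℕ s + d) _ ⟩
    (toℕ s + d + (n ∸ toℕ s)) % n         ≡⟨ cong (_% n) (xy∙z≈xz∙y (toℕ s) d (n ∸ toℕ s)) ⟩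
    (toℕ s + (n ∸ toℕ s) + d) % n         ≡⟨ cong (λ z → (z + d) % n) (m+[n∸m]≡n (<⇒≤ (toℕ<n s))) ⟩
    (n + d) % n                           ≡⟨ cong (_% n) (+-comm n d) ⟩
    (d + n) % n                           ≡⟨ [m+n]%n≡m%n d n ⟩
    d % n                                 ≡⟨ m<n⇒m%n≡m d<n ⟩
    d                                     ∎
    where open ≡-Reasoning

  offset-self : ∀ s → offset s s ≡ 0
  offset-self s = trans (cong (offset s) (sym (⊕-identityʳ s))) (offset-⊕ s 0 0<n)

  ⊕-injective : ∀ s {a b} → a < n → b < n → s ⊕ a ≡ s ⊕ b → a ≡ b
  ⊕-injective s {a} {b} a<n b<n eq = begin
    a                ≡⟨ offset-⊕ s a a<n ⟨
    offset s (s ⊕ a) ≡⟨ cong (offset s) eq ⟩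
    offset s (s ⊕ b) ≡⟨ offset-⊕ s b b<n ⟩
    b                ∎
    where open ≡-Reasoning

  ⊕-≢ : ∀ s {d} → 0 < d → d < n → s ⊕ d ≢ s
  ⊕-≢ s 0<d d<n eq = <-irrefl refl (subst (0 <_) (⊕-injective s d<n 0<n (trans eq (sym (⊕-identityʳ s)))) 0<d)

  offset-flip : ∀ v w → 0 < offset v w → offset w v ≡ n ∸ offset v w
  offset-flip v w 0<k = begin
    offset w v                  ≡⟨ cong (offset w) w⊕[n∸k]≡v ⟨
    offset w (w ⊕ (n ∸ k))      ≡⟨ offset-⊕ w (n ∸ k) (∸-monoʳ-< 0<k (<⇒≤ (offset<n v w))) ⟩
    n ∸ k                       ∎
    where
    open ≡-Reasoning
    k = offset v w
    w⊕[n∸k]≡v : w ⊕ (n ∸ k) ≡ v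
    w⊕[n∸k]≡v = begin
      w ⊕ (n ∸ k)          ≡⟨ cong (_⊕ (n ∸ k)) (⊕-offset v w) ⟨
      v ⊕ k ⊕ (n ∸ k)      ≡⟨ ⊕-assoc v k (n ∸ k) ⟩
      v ⊕ (k + (n ∸ k))    ≡⟨ cong (v ⊕_) (m+[n∸m]≡n (<⇒≤ (offset<n v w))) ⟩
      v ⊕ n                ≡⟨ ⊕-n v ⟩
      v                    ∎

  -- cycleGraph n i j unfolds to adjacent (toℕ i) (toℕ j).
  adjacent : ℕ → ℕ → Bool
  adjacent a b = (b ≡ᵇ suc a) ∨ (a ≡ᵇ suc b) ∨ ((a ≡ᵇ 0) ∧ (suc b ≡ᵇ n)) ∨ ((b ≡ᵇ 0) ∧ (suc a ≡ᵇ n))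

  adjacent-succ : ∀ a b → b ≡ suc a ⊎ (b ≡ 0 × suc a ≡ n) → T (adjacent a b) × T (adjacent b a)
  adjacent-succ a .(suc a) (inj₁ refl) =
    T-∨ˡ (≡⇒≡ᵇ a a refl) , T-∨ʳ {a ≡ᵇ suc (suc a)} (T-∨ˡ (≡⇒≡ᵇ a a refl))
  -- the disjuncts 0 ≡ᵇ suc a reduce to false
  adjacent-succ a .0 (inj₂ (refl , 1+a≡n)) =
    T-∨ʳ {a ≡ᵇ 1} (T-∨ʳ {(a ≡ᵇ 0) ∧ (1 ≡ᵇ n)} (≡⇒≡ᵇ _ n 1+a≡n)) ,
    T-∨ʳ {a ≡ᵇ 1} (T-∨ˡ (≡⇒≡ᵇ _ n 1+a≡n))

  edge-⊕1 : ∀ x → T (C x (x ⊕ 1)) × T (C (x ⊕ 1) x)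
  edge-⊕1 x = adjacent-succ (toℕ x) (toℕ (x ⊕ 1)) successor
    where
    open ≡-Reasoning
    successor : toℕ (x ⊕ 1) ≡ suc (toℕ x) ⊎ (toℕ (x ⊕ 1) ≡ 0 × suc (toℕ x) ≡ n)
    successor with suc (toℕ x) <? n
    ... | yes 1+x<n = inj₁ (begin
      toℕ (x ⊕ 1)       ≡⟨ toℕ-⊕ x 1 ⟩
      (toℕ x + 1) % n   ≡⟨ cong (_% n) (+-comm (toℕ x) 1) ⟩
      suc (toℕ x) % n   ≡⟨ m<n⇒m%n≡m 1+x<n ⟩
      suc (toℕ x)       ∎)
    ... | no 1+x≮n = inj₂ ((begin
      toℕ (x ⊕ 1)       ≡⟨ toℕ-⊕ x 1 ⟩
      (toℕ x + 1) % n   ≡⟨ cong (_% n) (trans (+-comm (toℕ x) 1) 1+x≡n) ⟩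
      n % n             ≡⟨ n%n≡0 n ⟩
      0                 ∎) , 1+x≡n)
      where 1+x≡n = ≤-antisym (toℕ<n x) (≮⇒≥ 1+x≮n)

  walk-⊕ : ∀ d x → T (walk C d x (x ⊕ d))
  walk-⊕ zero    x = fromWitness (sym (⊕-identityʳ x))
  walk-⊕ (suc d) x = any-intro _ (∈-allFin (x ⊕ 1))
    (T-∧⁺ (proj₁ (edge-⊕1 x)) (subst (T ∘ walk C d (x ⊕ 1)) (⊕-assoc x 1 d) (walk-⊕ d (x ⊕ 1))))

  walk-⊕⁻ : ∀ d x → T (walk C d (x ⊕ d) x)
  walk-⊕⁻ zero    x = fromWitness (⊕-identityʳ x)
  walk-⊕⁻ (suc d) x = any-intro _ (∈-allFin (x ⊕ d))
    (T-∧⁺ (subst (λ y → T (C y (x ⊕ d))) x⊕d⊕1≡x⊕[1+d] (proj₂ (edge-⊕1 (x ⊕ d)))) (walk-⊕⁻ d x))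
    where x⊕d⊕1≡x⊕[1+d] = trans (⊕-assoc x d 1) (cong (x ⊕_) (+-comm d 1))

  N : ℤ
  N = + n

  -- x and y, read in ℤ/nℤ, are at distance at most c
  record Near (c : ℕ) (x y : ℤ) : Set where
    constructor near
    field
      winding : ℤ
      bound   : ∣ x -ℤ y +ℤ winding *ℤ N ∣ ≤ c

  near-sym : ∀ {c x y} → Near c x y → Near c y x
  near-sym {c} {x} {y} (near t ∣x-y+tN∣≤c) = near (- t) (subst (_≤ c) (begin
    ∣ x -ℤ y +ℤ t *ℤ N ∣         ≡⟨ ℤ.∣-i∣≡∣i∣ (x -ℤ y +ℤ t *ℤ N) ⟨
    ∣ - (x -ℤ y +ℤ t *ℤ N) ∣     ≡⟨ cong ∣_∣ (diff-negate x y t N) ⟩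
    ∣ y -ℤ x +ℤ - t *ℤ N ∣       ∎) ∣x-y+tN∣≤c)
    where open ≡-Reasoning

  near-refl : ∀ x → Near 0 x x
  near-refl x = near 0ℤ (≤-reflexive (cong ∣_∣ (diff-self x N)))

  near-trans : ∀ {a b x y z} → Near a x y → Near b y z → Near (a + b) x z
  near-trans {a} {b} {x} {y} {z} (near t ∣x-y+tN∣≤a) (near u ∣y-z+uN∣≤b) = near (t +ℤ u) (begin
    ∣ x -ℤ z +ℤ (t +ℤ u) *ℤ N ∣                         ≡⟨ cong ∣_∣ (diff-add x y z t u N) ⟨
    ∣ (x -ℤ y +ℤ t *ℤ N) +ℤ (y -ℤ z +ℤ u *ℤ N) ∣        ≤⟨ ℤ.∣i+j∣≤∣i∣+∣j∣ (x -ℤ y +ℤ t *ℤ N) (y -ℤ z +ℤ u *ℤ N) ⟩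
    ∣ x -ℤ y +ℤ t *ℤ N ∣ + ∣ y -ℤ z +ℤ u *ℤ N ∣         ≤⟨ +-mono-≤ ∣x-y+tN∣≤a ∣y-z+uN∣≤b ⟩
    a + b                                               ∎)
    where open ≤-Reasoning

  near-shift : ∀ s q r {c x y x′ y′} → Near c x y →
               s +ℤ x′ ≡ x +ℤ q *ℤ N → s +ℤ y′ ≡ y +ℤ r *ℤ N → Near c x′ y′
  near-shift s q r {c} {x} {y} {x′} {y′} (near t ∣x-y+tN∣≤c) e₁ e₂ =
    near (t -ℤ q +ℤ r) (subst (_≤ c) (cong ∣_∣ (sym (begin
      x′ -ℤ y′ +ℤ (t -ℤ q +ℤ r) *ℤ N                      ≡⟨ diff-translate s x′ y′ _ ⟩
      (s +ℤ x′) -ℤ (s +ℤ y′) +ℤ (t -ℤ q +ℤ r) *ℤ N        ≡⟨ cong₂ (λ u v → u -ℤ v +ℤ (t -ℤ q +ℤ r) *ℤ N) e₁ e₂ ⟩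
      (x +ℤ q *ℤ N) -ℤ (y +ℤ r *ℤ N) +ℤ (t -ℤ q +ℤ r) *ℤ N ≡⟨ diff-shift x y q r t N ⟩
      x -ℤ y +ℤ t *ℤ N                                    ∎))) ∣x-y+tN∣≤c)
    where open ≡-Reasoning

  near-succ : ∀ a → Near 1 (+ a) (+ suc a)
  near-succ a = near 0ℤ (≤-reflexive (cong ∣_∣ (diff-succ (+ a) N)))

  near-wrap : ∀ a → suc a ≡ n → Near 1 (+ a) (+ 0)
  near-wrap a 1+a≡n = near -1ℤ (≤-reflexive (begin
    ∣ + a -ℤ 0ℤ +ℤ -1ℤ *ℤ + n ∣       ≡⟨ cong (λ m → ∣ + a -ℤ 0ℤ +ℤ -1ℤ *ℤ + m ∣) 1+a≡n ⟨
    ∣ + a -ℤ 0ℤ +ℤ -1ℤ *ℤ + suc a ∣   ≡⟨ cong ∣_∣ (diff-wrap (+ a)) ⟩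
    1                                 ∎))
    where open ≡-Reasoning

  near-adjacent : ∀ a b → T (adjacent a b) → Near 1 (+ a) (+ b)
  near-adjacent a b h with T-∨⁻ (b ≡ᵇ suc a) h
  ... | inj₁ b≡1+a rewrite ≡ᵇ⇒≡ b (suc a) b≡1+a = near-succ a
  ... | inj₂ h′ with T-∨⁻ (a ≡ᵇ suc b) h′
  ...   | inj₁ a≡1+b rewrite ≡ᵇ⇒≡ a (suc b) a≡1+b = near-sym (near-succ b)
  ...   | inj₂ h″ with T-∨⁻ ((a ≡ᵇ 0) ∧ (suc b ≡ᵇ n)) h″
  ...     | inj₁ wrap with T-∧⁻ wrap
  ...       | a≡0 , 1+b≡n rewrite ≡ᵇ⇒≡ a 0 a≡0 = near-sym (near-wrap b (≡ᵇ⇒≡ _ n 1+b≡n))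
  near-adjacent a b h | inj₂ _ | inj₂ _ | inj₂ wrap with T-∧⁻ wrap
  ...       | b≡0 , 1+a≡n rewrite ≡ᵇ⇒≡ b 0 b≡0 = near-wrap a (≡ᵇ⇒≡ _ n 1+a≡n)

  near-walk : ∀ c x y → T (walk C c x y) → Near c (+ toℕ x) (+ toℕ y)
  near-walk zero x y x≡y rewrite toWitness x≡y = near-refl (+ toℕ y)
  near-walk (suc c) x y h with any-elim _ (allFin n) h
  ... | w , _ , xw∧wy with T-∧⁻ xw∧wy
  ...   | xw , wy = near-trans (near-adjacent (toℕ x) (toℕ w) xw) (near-walk c w y wy)

  lift-⊕ : ∀ s d → + toℕ s +ℤ + d ≡ + toℕ (s ⊕ d) +ℤ + ((toℕ s + d) / n) *ℤ N
  lift-⊕ s d = begin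
    + toℕ s +ℤ + d                                  ≡⟨ ℤ.pos-+ (toℕ s) d ⟨
    + (toℕ s + d)                                   ≡⟨ cong +_ (m≡m%n+[m/n]*n (toℕ s + d) n) ⟩
    + ((toℕ s + d) % n + (toℕ s + d) / n * n)       ≡⟨ ℤ.pos-+ ((toℕ s + d) % n) _ ⟩
    + ((toℕ s + d) % n) +ℤ + ((toℕ s + d) / n * n)  ≡⟨ cong₂ _+ℤ_ (cong +_ (sym (toℕ-⊕ s d))) (ℤ.pos-* ((toℕ s + d) / n) n) ⟩
    + toℕ (s ⊕ d) +ℤ + ((toℕ s + d) / n) *ℤ N       ∎
    where open ≡-Reasoning

  near-offset : ∀ s {c y z} → T (walk C c y z) → Near c (+ offset s y) (+ offset s z)
  near-offset s {c} {y} {z} h = near-shift (+ toℕ s) (quotient y) (quotient z) (near-walk c y z h) (lift-offset y) (lift-offset z)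
    where
    quotient : Fin n → ℤ
    quotient y = + ((toℕ s + offset s y) / n)
    lift-offset : ∀ y → + toℕ s +ℤ + offset s y ≡ + toℕ y +ℤ quotient y *ℤ N
    lift-offset y = subst (λ x → + toℕ s +ℤ + offset s y ≡ + toℕ x +ℤ quotient y *ℤ N)
                          (⊕-offset s y) (lift-⊕ s (offset s y))

  near-bound : ∀ {c i k} → Near c (+ i) (+ k) → i ≤ k → k ≤ c + i ⊎ n + i ≤ c + k
  near-bound {c} {i} {k} (near t ∣i-k+tN∣≤c) i≤k with t ℤ.≟ 0ℤ
  ... | yes refl = inj₁ (begin
    k                 ≡⟨ m∸n+n≡m i≤k ⟨
    k ∸ i + i         ≡⟨ cong (_+ i) (∣i-k∣≡k∸i i≤k) ⟨
    ∣ + i -ℤ + k ∣ + i  ≡⟨ cong (λ z → ∣ z ∣ + i) (diff-0N (+ i) (+ k) N) ⟨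
    ∣ + i -ℤ + k +ℤ 0ℤ *ℤ N ∣ + i ≤⟨ +-monoˡ-≤ i ∣i-k+tN∣≤c ⟩
    c + i             ∎)
    where open ≤-Reasoning
  ... | no t≢0 = inj₂ (begin
    n + i                                        ≤⟨ +-monoˡ-≤ i n≤∣tN∣ ⟩
    ∣ t *ℤ N ∣ + i                               ≡⟨ cong (λ z → ∣ z ∣ + i) (add-sub-cancel (+ i -ℤ + k) (t *ℤ N)) ⟨
    ∣ (+ i -ℤ + k +ℤ t *ℤ N) -ℤ (+ i -ℤ + k) ∣ + i ≤⟨ +-monoˡ-≤ i (ℤ.∣i-j∣≤∣i∣+∣j∣ (+ i -ℤ + k +ℤ t *ℤ N) (+ i -ℤ + k)) ⟩
    ∣ + i -ℤ + k +ℤ t *ℤ N ∣ + ∣ + i -ℤ + k ∣ + i ≤⟨ +-monoˡ-≤ i (+-monoˡ-≤ _ ∣i-k+tN∣≤c) ⟩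
    c + ∣ + i -ℤ + k ∣ + i                       ≡⟨ cong (λ z → c + z + i) (∣i-k∣≡k∸i i≤k) ⟩
    c + (k ∸ i) + i                              ≡⟨ +-assoc c (k ∸ i) i ⟩
    c + (k ∸ i + i)                              ≡⟨ cong (λ z → c + z) (m∸n+n≡m i≤k) ⟩
    c + k                                        ∎)
    where
    open ≤-Reasoning
    n≤∣tN∣ : n ≤ ∣ t *ℤ N ∣
    n≤∣tN∣ = begin
      n            ≤⟨ m≤n*m n ∣ t ∣ {{≢-nonZero (t≢0 ∘ ℤ.∣i∣≡0⇒i≡0)}} ⟩
      ∣ t ∣ * n    ≡⟨ ℤ.abs-* t N ⟨
      ∣ t *ℤ N ∣   ∎

  half<n : ∀ {d} → d + d ≤ n → d < n
  half<n {zero}  _  = 0<n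
  half<n {suc d} dd = <-≤-trans (m<m+n (suc d) z<s) dd

  walk-length-≥ : ∀ {c x d} → T (walk C c x (x ⊕ d)) → d + d ≤ n → d ≤ c
  walk-length-≥ {c} {x} {d} h dd
    with near-bound (subst₂ (λ i k → Near c (+ i) (+ k)) (offset-self x) (offset-⊕ x d (half<n dd)) (near-offset x h)) z≤n
  ... | inj₁ d≤c+0 = subst (d ≤_) (+-identityʳ c) d≤c+0
  ... | inj₂ n≤c+d = +-cancelʳ-≤ d d c (≤-trans dd (subst (_≤ c + d) (+-identityʳ n) n≤c+d))

  arc-shortest : ∀ x {d e} → e ≤ d → d + d ≤ n → T (onShortestPath C x (x ⊕ d) (x ⊕ e))
  arc-shortest x {d} {e} e≤d dd = onShortestPath⁺ geodesic (≤-trans e≤d d≤n) (≤-trans (m∸n≤m d e) d≤n)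
    where
    d≤n = <⇒≤ (half<n dd)
    geodesic : OnShortestPath x (x ⊕ d) (x ⊕ e)
    geodesic = record
      { before      = e
      ; after       = d ∸ e
      ; walk-before = walk-⊕ e x
      ; walk-after  = subst (T ∘ walk C (d ∸ e) (x ⊕ e))
                            (trans (⊕-assoc x e (d ∸ e)) (cong (x ⊕_) (m+[n∸m]≡n e≤d)))
                            (walk-⊕ (d ∸ e) (x ⊕ e))
      ; shortest    = λ c c<e+[d∸e] w → <⇒≱ (subst (c <_) (m+[n∸m]≡n e≤d) c<e+[d∸e]) (walk-length-≥ w dd)
      }

  convex-segment : ∀ {S} p {a b j} → Convex S → T (S (p ⊕ a)) → T (S (p ⊕ b)) →
                   a ≤ j → j ≤ b → (b ∸ a) + (b ∸ a) ≤ n → T (S (p ⊕ j))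
  convex-segment {S} p {a} {b} {j} conv sa sb a≤j j≤b short =
    subst (T ∘ S) (shift j a≤j)
      (conv (p ⊕ a) _ _ sa (subst (T ∘ S) (sym (shift b (≤-trans a≤j j≤b))) sb)
            (arc-shortest (p ⊕ a) (∸-monoˡ-≤ a j≤b) short))
    where
    shift : ∀ k → a ≤ k → p ⊕ a ⊕ (k ∸ a) ≡ p ⊕ k
    shift k a≤k = trans (⊕-assoc p a (k ∸ a)) (cong (p ⊕_) (m+[n∸m]≡n a≤k))

  arc : Fin n → ℕ → VSet n
  arc s m y = offset s y ≤ᵇ m

  walk-between : ∀ s {u v} → offset s u ≤ offset s v →
                 let D = offset s v ∸ offset s u in T (walk C D u v) × T (walk C D v u)
  walk-between s {u} {v} i≤j =
    subst (T ∘ walk C D u) u⊕D≡v (walk-⊕ D u) , subst (λ x → T (walk C D x u)) u⊕D≡v (walk-⊕⁻ D u)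
    where
    D = offset s v ∸ offset s u
    u⊕D≡v : u ⊕ D ≡ v
    u⊕D≡v = begin
      u ⊕ D                          ≡⟨ cong (_⊕ D) (⊕-offset s u) ⟨
      s ⊕ offset s u ⊕ D             ≡⟨ ⊕-assoc s (offset s u) D ⟩
      s ⊕ (offset s u + D)           ≡⟨ cong (s ⊕_) (m+[n∸m]≡n i≤j) ⟩
      s ⊕ offset s v                 ≡⟨ ⊕-offset s v ⟩
      v                              ∎
      where open ≡-Reasoning

  arc-walk : ∀ s {m u v} → offset s u ≤ m → offset s v ≤ m →
             let i = offset s u ; j = offset s v in
             ∃[ D ] T (walk C D u v) × D + (i + j) ≤ m + m × D ≤ i + j
  arc-walk s {m} {u} {v} i≤m j≤m with ≤-total (offset s u) (offset s v)
  ... | inj₁ i≤j = _ , proj₁ (walk-between s i≤j) , distance-bounds i≤j j≤m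
  ... | inj₂ j≤i = _ , proj₂ (walk-between s j≤i) ,
                   subst (λ z → D + z ≤ m + m × D ≤ z) (+-comm (offset s v) (offset s u)) (distance-bounds j≤i i≤m)
    where D = offset s u ∸ offset s v

  arc-convex : ∀ s {m} → m + m < n → Convex (arc s m)
  arc-convex s {m} m+m<n u v w su sv h with offset s w ≤? m
  ... | yes k≤m = ≤⇒≤ᵇ k≤m
  ... | no k≰m with arc-walk s (≤ᵇ⇒≤ _ _ su) (≤ᵇ⇒≤ _ _ sv)
  ...   | D , walk-uv , D+[i+j]≤m+m , D≤i+j =
    ⊥-elim (outside-arc-unreachable m+m<n m<k (offset<n s w)
      (≤-trans (+-monoˡ-≤ _ a+b≤D) D+[i+j]≤m+m) (≤-trans a+b≤D D≤i+j)
      (near-bound (near-offset s {before} walk-before) (≤-trans (≤ᵇ⇒≤ _ _ su) (<⇒≤ m<k)))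
      (near-bound (near-sym (near-offset s {after} walk-after)) (≤-trans (≤ᵇ⇒≤ _ _ sv) (<⇒≤ m<k))))
    where
    open OnShortestPath (onShortestPath⁻ h)
    m<k = ≰⇒> k≰m
    a+b≤D = ≮⇒≥ (λ D<a+b → shortest D D<a+b walk-uv)

  generating-by-offsets : ∀ {P} p → (∀ S → Convex S → P ⊆ S → ∀ j → j < n → T (S (p ⊕ j))) →
                          T (generating C P)
  generating-by-offsets p cover = generating⁺ λ S conv P⊆S y →
    subst (T ∘ S) (⊕-offset p y) (cover S conv P⊆S (offset p y) (offset<n p y))

  some-vertex : Fin n
  some-vertex = fromℕ< 0<n

  ∅-nonGenerating : ¬ T (generating C ∅)
  ∅-nonGenerating = nonGenerating {y = some-vertex} ∅-convex (λ _ ()) (λ ())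

  singleton-nonGenerating : 1 < n → ∀ v → ¬ T (generating C (insertV ∅ v))
  singleton-nonGenerating 1<n v = nonGenerating (singleton-convex v) (λ _ sv → sv)
    (∉-insertV {P = ∅} {v = v} {y = v ⊕ 1} (⊕-≢ v z<s 1<n) (λ ()))

  ∉-singleton : ∀ {v w} → ¬ T (insertV ∅ v w) → w ≢ v
  ∉-singleton {v} w∉ refl = w∉ (∈-insertV {n} ∅ v)

  ⊕-offset-+ : ∀ p q d → p ⊕ (offset p q + d) ≡ q ⊕ d
  ⊕-offset-+ p q d = trans (sym (⊕-assoc p (offset p q) d)) (cong (_⊕ d) (⊕-offset p q))

  offset-pos : ∀ {p q} → q ≢ p → 0 < offset p q
  offset-pos {p} {q} q≢p with offset p q in k≡
  ... | zero  = contradiction (trans (sym (⊕-offset p q)) (trans (cong (p ⊕_) k≡) (⊕-identityʳ p))) q≢p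
  ... | suc _ = z<s

  module EvenCycle {m} (n≡m+m : n ≡ m + m) (1≤m : 1 ≤ m) where

    antipodal-generating : ∀ {P} v → T (P v) → T (P (v ⊕ m)) → T (generating C P)
    antipodal-generating {P} v pv pv⊕m = generating-by-offsets v cover
      where
      cover : ∀ S → Convex S → P ⊆ S → ∀ j → j < n → T (S (v ⊕ j))
      cover S conv P⊆S j j<n with j ≤? m
      ... | yes j≤m = convex-segment v conv (subst (T ∘ S) (sym (⊕-identityʳ v)) (P⊆S v pv)) (P⊆S _ pv⊕m)
                        z≤n j≤m (≤-reflexive (sym n≡m+m))
      ... | no j≰m  = convex-segment v conv (P⊆S _ pv⊕m) (subst (T ∘ S) (sym v⊕[m+m]≡v) (P⊆S v pv))
                        (<⇒≤ (≰⇒> j≰m)) (subst (j ≤_) n≡m+m (<⇒≤ j<n))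
                        (subst (λ d → d + d ≤ n) (sym (m+n∸m≡n m m)) (≤-reflexive (sym n≡m+m)))
        where v⊕[m+m]≡v = trans (cong (v ⊕_) (sym n≡m+m)) (⊕-n v)

    m<n : m < n
    m<n = subst (m <_) (sym n≡m+m) (m<m+n m 1≤m)

    nimGEN-even : nimGEN C ≡ 0
    nimGEN-even with m≤n⇒∃[o]m+o≡n (≤-trans (+-mono-≤ 1≤m 1≤m) (≤-reflexive (sym n≡m+m)))
    ... | f , 2+f≡n = subst (λ k → nimFrom C k ∅ ≡ 0) 2+f≡n
      (nimFrom≡0 {f = suc f} ∅-nonGenerating λ v _ →
        nimFrom≢0 {f = f} (singleton-nonGenerating (<-≤-trans (s≤s 1≤m) m<n) v)
                  (∉-insertV {P = ∅} {v = v} {y = v ⊕ m} (⊕-≢ v 1≤m m<n) (λ ()))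
                  (antipodal-generating v (∈-pairˡ v (v ⊕ m)) (∈-pairʳ v (v ⊕ m))))

  module OddCycle {m} (n≡1+m+m : n ≡ suc (m + m)) (1≤m : 1 ≤ m) where

    m+m<n : m + m < n
    m+m<n = ≤-reflexive (sym n≡1+m+m)

    m<n : m < n
    m<n = ≤-<-trans (m≤m+n m m) m+m<n

    1+m<n : suc m < n
    1+m<n = subst (suc m <_) (sym n≡1+m+m) (s≤s (subst (_≤ m + m) (+-comm m 1) (+-monoʳ-≤ m 1≤m)))

    pair-in-arc-nonGenerating : ∀ s {v w} → T (arc s m v) → T (arc s m w) → ¬ T (generating C (pair v w))
    pair-in-arc-nonGenerating s {v} {w} v∈arc w∈arc =
      nonGenerating {y = s ⊕ suc m} (arc-convex s m+m<n) pair⊆arc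
        (λ h → <-irrefl refl (≤ᵇ⇒≤ (suc m) m (subst (λ k → T (k ≤ᵇ m)) (offset-⊕ s (suc m) 1+m<n) h)))
      where
      pair⊆arc : pair v w ⊆ arc s m
      pair⊆arc x x∈pair with ∈-pair⁻ {v = v} {w} {x} x∈pair
      ... | inj₁ refl = v∈arc
      ... | inj₂ refl = w∈arc

    self∈arc : ∀ s → T (arc s m s)
    self∈arc s = ≤⇒≤ᵇ (subst (_≤ m) (sym (offset-self s)) z≤n)

    offset-flip-≤ : ∀ v w → m < offset v w → offset w v ≤ m
    offset-flip-≤ v w m<k = begin
      offset w v            ≡⟨ offset-flip v w (≤-<-trans z≤n m<k) ⟩
      n ∸ offset v w        ≤⟨ ∸-monoʳ-≤ n m<k ⟩
      n ∸ suc m             ≡⟨ cong (_∸ suc m) n≡1+m+m ⟩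
      m + m ∸ m             ≡⟨ m+n∸m≡n m m ⟩
      m                     ∎
      where open ≤-Reasoning

    pair-nonGenerating : ∀ v w → ¬ T (generating C (pair v w))
    pair-nonGenerating v w with offset v w ≤? m
    ... | yes k≤m = pair-in-arc-nonGenerating v (self∈arc v) (≤⇒≤ᵇ k≤m)
    ... | no k≰m  = pair-in-arc-nonGenerating w (≤⇒≤ᵇ (offset-flip-≤ v w (≰⇒> k≰m))) (self∈arc w)

    triangle-generating : ∀ {P} p q → q ≢ p → offset p q ≤ m →
                          T (P p) → T (P q) → T (P (q ⊕ m)) → T (generating C P)
    triangle-generating {P} p q q≢p k≤m pp pq pr = generating-by-offsets p cover
      where
      k = offset p q
      k+k≤n = ≤-trans (+-mono-≤ k≤m k≤m) (<⇒≤ m+m<n)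
      p⊕k≡q = ⊕-offset p q
      p⊕[k+m]≡q⊕m = ⊕-offset-+ p q m
      n∸[k+m]≤m : n ∸ (k + m) ≤ m
      n∸[k+m]≤m = m≤n+o⇒m∸n≤o n (k + m) (begin
        n             ≡⟨ n≡1+m+m ⟩
        1 + (m + m)   ≤⟨ +-monoˡ-≤ (m + m) (offset-pos q≢p) ⟩
        k + (m + m)   ≡⟨ +-assoc k m m ⟨
        k + m + m     ∎)
        where open ≤-Reasoning
      cover : ∀ S → Convex S → P ⊆ S → ∀ j → j < n → T (S (p ⊕ j))
      cover S conv P⊆S j j<n with j ≤? k | j ≤? k + m
      ... | yes j≤k | _ =
        convex-segment p conv sp (subst (T ∘ S) (sym p⊕k≡q) (P⊆S q pq)) z≤n j≤k k+k≤n
        where sp = subst (T ∘ S) (sym (⊕-identityʳ p)) (P⊆S p pp)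
      ... | no j≰k | yes j≤k+m =
        convex-segment p conv (subst (T ∘ S) (sym p⊕k≡q) (P⊆S q pq)) (subst (T ∘ S) (sym p⊕[k+m]≡q⊕m) (P⊆S _ pr))
          (<⇒≤ (≰⇒> j≰k)) j≤k+m (subst (λ d → d + d ≤ n) (sym (m+n∸m≡n k m)) (<⇒≤ m+m<n))
      ... | _ | no j≰k+m =
        convex-segment p conv (subst (T ∘ S) (sym p⊕[k+m]≡q⊕m) (P⊆S _ pr)) (subst (T ∘ S) (sym (⊕-n p)) (P⊆S p pp))
          (<⇒≤ (≰⇒> j≰k+m)) (<⇒≤ j<n) (≤-trans (+-mono-≤ n∸[k+m]≤m n∸[k+m]≤m) (<⇒≤ m+m<n))

    third≢second : ∀ q → q ⊕ m ≢ q
    third≢second q = ⊕-≢ q 1≤m m<n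

    third≢first : ∀ p q → offset p q ≤ m → q ⊕ m ≢ p
    third≢first p q k≤m = ⊕-≢ p (≤-trans 1≤m (m≤n+m m _)) (≤-<-trans (+-monoˡ-≤ m k≤m) m+m<n)
                          ∘ trans (⊕-offset-+ p q m)

    triangle-move-wins : ∀ f {v w} p q → q ≢ p → offset p q ≤ m → T (pair v w p) → T (pair v w q) →
                       q ⊕ m ≢ v → q ⊕ m ≢ w → nimFrom C (suc f) (pair v w) ≢ 0
    triangle-move-wins f {v} {w} p q q≢p k≤m pp pq x≢v x≢w =
      nimFrom≢0 {f = f} (pair-nonGenerating v w) (∉-pair x≢v x≢w)
        (triangle-generating p q q≢p k≤m (old p pp) (old q pq) (∈-insertV (pair v w) (q ⊕ m)))
      where old = ∈-insertV-old {P = pair v w} (q ⊕ m)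

    pair-nimFrom≢0 : ∀ f v w → w ≢ v → nimFrom C (suc f) (pair v w) ≢ 0
    pair-nimFrom≢0 f v w w≢v with offset v w ≤? m
    ... | yes k≤m = triangle-move-wins f v w w≢v k≤m (∈-pairˡ v w) (∈-pairʳ v w)
                      (third≢first v w k≤m) (third≢second w)
    ... | no k≰m  = triangle-move-wins f w v (w≢v ∘ sym) l≤m (∈-pairʳ v w) (∈-pairˡ v w)
                      (third≢second v) (third≢first w v l≤m)
      where l≤m = offset-flip-≤ v w (≰⇒> k≰m)

    singleton-nimFrom≡0 : ∀ f v → nimFrom C (suc (suc f)) (insertV ∅ v) ≡ 0
    singleton-nimFrom≡0 f v = nimFrom≡0 {f = suc f} (singleton-nonGenerating (≤-<-trans 1≤m m<n) v)
      λ w w∉ → pair-nimFrom≢0 f v w (∉-singleton w∉)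

    nimGEN-odd : nimGEN C ≡ 1
    nimGEN-odd with m≤n⇒∃[o]m+o≡n (subst (3 ≤_) (sym n≡1+m+m) (s≤s (+-mono-≤ 1≤m 1≤m)))
    ... | f , 3+f≡n = subst (λ k → nimFrom C k ∅ ≡ 1) 3+f≡n
      (nimFrom≡1 {f = suc (suc f)} {v = some-vertex} ∅-nonGenerating (λ ()) λ v _ → singleton-nimFrom≡0 f v)

parity-split : ∀ n → ∃[ m ] (n ≡ m + m ⊎ n ≡ suc (m + m))
parity-split zero    = 0 , inj₁ refl
parity-split (suc n) with parity-split n
... | m , inj₁ n≡m+m   = m , inj₂ (cong suc n≡m+m)
... | m , inj₂ n≡1+m+m = suc m , inj₁ (trans (cong suc n≡1+m+m) (cong suc (sym (+-suc m m))))

pty-even : ∀ m → pty (m + m) ≡ 0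
pty-even m = trans (cong (_% 2) (trans (cong (λ k → m + k) (sym (+-identityʳ m))) (*-comm 2 m))) (m*n%n≡0 m 2)

pty-odd : ∀ m → pty (suc (m + m)) ≡ 1
pty-odd m = trans (cong (λ k → suc k % 2) (trans (cong (λ k → m + k) (sym (+-identityʳ m))) (*-comm 2 m))) ([m+kn]%n≡m%n 1 m 2)

proposition7p4 : (n : ℕ) → 3 ≤ n → nimGEN (cycleGraph n) ≡ pty n
proposition7p4 n 3≤n = by-parity (parity-split n)
  where
  open ≡-Reasoning
  instance
    n≢0 : NonZero n
    n≢0 = >-nonZero (≤-trans (s≤s z≤n) 3≤n)
  by-parity : ∃[ m ] (n ≡ m + m ⊎ n ≡ suc (m + m)) → nimGEN (cycleGraph n) ≡ pty n
  by-parity (zero , inj₁ n≡0) = contradiction (subst (3 ≤_) n≡0 3≤n) λ ()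
  by-parity (zero , inj₂ n≡1) = contradiction (subst (3 ≤_) n≡1 3≤n) λ { (s≤s ()) }
  by-parity (suc m , inj₁ n≡m+m) = begin
    nimGEN (cycleGraph n)      ≡⟨ Cycle.EvenCycle.nimGEN-even n n≡m+m (s≤s z≤n) ⟩
    0                          ≡⟨ pty-even (suc m) ⟨
    pty (suc m + suc m)        ≡⟨ cong pty n≡m+m ⟨
    pty n                      ∎
  by-parity (suc m , inj₂ n≡1+m+m) = begin
    nimGEN (cycleGraph n)      ≡⟨ Cycle.OddCycle.nimGEN-odd n n≡1+m+m (s≤s z≤n) ⟩
    1                          ≡⟨ pty-odd (suc m) ⟨
    pty (suc (suc m + suc m))  ≡⟨ cong pty n≡1+m+m ⟨
    pty n                      ∎
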